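{- Let $M=\{1^{k_{1}},2^{k_{2}},\ldots,m^{k_{m}}\}$ with $k_{i}\geq1$ for all $i\in[m]$, let $\tau$ be a consecutive permutation of $[m]$, and let $d$ be a positive integer. Then $F_{d}(\mathfrak{S}_{M}^{\tau})=\mathfrak{S}_{M}^{\tau}$.
   Context: $\mathfrak{S}_M$: words that are rearrangements of the multiset with $k_i$ copies of $i$ ($n=\sum k_i$). Tail permutation of $w$: the subword formed by the last occurrences of each letter; $\mathfrak{S}_M^\tau$: words in $\mathfrak{S}_M$ with tail permutation $\tau$. A permutation $\tau_1\cdots\tau_m$ is consecutive if each $\{\tau_1,\dots,\tau_i\}$ is a set of consecutive integers. Operator $J_x$: for a word $v=v_1\cdots v_k$ and letter $x$, if $v_k\le x$ factor $v=u_1b_1\cdots u_sb_s$ with each letter $b_i\le x$ and all letters of each (possibly empty) $u_i$ greater than $x$; if $v_k>x$ factor with each $b_i>x$ and all letters of each $u_i$ at most $x$; then $J_x(v)=b_1u_1\cdots b_su_s$ (and $J_x$ of the empty word is empty). The map $F_d$: for $w=w_1\cdots w_n$, put $\gamma_i=w_1\cdots w_i$ for $1\le i\le d$ (with $i\le n$); for $d\le i\le n-1$, writing $\gamma_i=c_1c_2\cdots c_i$, put $\gamma_{i+1}=J_{w_{i+1}}(c_1\cdots c_{i-d+1})\,c_{i-d+2}\cdots c_i\,w_{i+1}$; finally $F_d(w)=\gamma_n$. ($F_d$ is a bijection of $\mathfrak{S}_M$ with $\mathrm{MAJ}_d(w)=\mathrm{INV}(F_d(w))$.) -}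

module Defs where

open import Data.Nat using (ℕ; zero; suc; _≤_; _∸_; _+_; _<_; _≤ᵇ_; _<ᵇ_; _≡ᵇ_)
open import Data.Bool using (Bool; true; false; if_then_else_)
open import Data.List using (List; []; _∷_; _++_; [_]; take; drop; length; foldl; replicate; concatMap; map; upTo; last)
open import Data.Bool.ListAction using (any)
open import Data.Maybe using (Maybe; just; nothing)
open import Data.Fin using (Fin; toℕ)
open import Data.List using (allFin)
open import Data.List.Membership.Propositional using (_∈_)
open import Data.List.Relation.Binary.Permutation.Propositional using (_↭_)

-- Words are lists of natural numbers; the alphabet [m] is {1,…,m}.

-- The multiset M = {1^{k_1},…,m^{k_m}}, given by k : Fin m → ℕ
-- (k i is the multiplicity of the letter toℕ i + 1), written out as
-- the nondecreasing word 1^{k_1} 2^{k_2} ⋯ m^{k_m}.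
multisetWord : (m : ℕ) → (Fin m → ℕ) → List ℕ
multisetWord m k = concatMap (λ i → replicate (k i) (suc (toℕ i))) (allFin m)

InS : (m : ℕ) → (Fin m → ℕ) → List ℕ → Set
InS m k w = w ↭ multisetWord m k

elemᵇ : ℕ → List ℕ → Bool
elemᵇ x xs = any (λ y → x ≡ᵇ y) xs

tailPerm : List ℕ → List ℕ
tailPerm [] = []
tailPerm (x ∷ xs) = if elemᵇ x xs then tailPerm xs else x ∷ tailPerm xs

InSτ : (m : ℕ) → (Fin m → ℕ) → List ℕ → List ℕ → Set
InSτ m k τ w = InS m k w × tailPerm w ≡ τ
  where
  open import Data.Product using (_×_)
  open import Relation.Binary.PropositionalEquality using (_≡_)

range1 : ℕ → List ℕ
range1 m = map suc (upTo m)

ConsecutiveSet : List ℕ → Set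
ConsecutiveSet P = ∀ a b c → a ∈ P → b ∈ P → a ≤ c → c ≤ b → c ∈ P

Consecutive : List ℕ → Set
Consecutive τ = ∀ i → i ≤ length τ → ConsecutiveSet (take i τ)

-- helper for J_x: given a predicate picking out the "b" letters, turn
-- u_1 b_1 ⋯ u_s b_s into b_1 u_1 ⋯ b_s u_s (acc = the current u-block)
jAux : (ℕ → Bool) → List ℕ → List ℕ → List ℕ
jAux p acc [] = acc
jAux p acc (y ∷ ys) = if p y then y ∷ (acc ++ jAux p [] ys) else jAux p (acc ++ [ y ]) ys

J : ℕ → List ℕ → List ℕ
J x v with last v
... | nothing = []
... | just l = if l ≤ᵇ x then jAux (λ y → y ≤ᵇ x) [] v else jAux (λ y → x <ᵇ y) [] v

-- one step γ_i ↦ γ_{i+1} with new letter x = w_{i+1}, where i = length γ_i: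
-- if i < d, append x; otherwise
-- γ_{i+1} = J_x(c_1 ⋯ c_{i-d+1}) c_{i-d+2} ⋯ c_i x
Fstep : ℕ → List ℕ → ℕ → List ℕ
Fstep d γ x with length γ <ᵇ d
... | true = γ ++ [ x ]
... | false = J x (take (length γ ∸ d + 1) γ) ++ drop (length γ ∸ d + 1) γ ++ [ x ]

F : ℕ → List ℕ → List ℕ
F d w = foldl (Fstep d) [] w

-- Each step of F_d turns γ x into J_x(A) B x, where γ = A B, and J_x only rearranges A,
-- keeping its subword of letters ≤ x and its subword of letters > x. The letters whose last
-- occurrence lies in A form a prefix of the tail permutation, and this prefix avoids x because
-- x occurs later. When the tail permutation is consecutive, that prefix is a set of consecutive
-- integers avoiding x, hence lies on one side of x, and J_x does not change its order. So every
-- step preserves a consecutive tail permutation, read forwards or backwards. Surjectivity comes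
-- from a right inverse of J_x, which regroups b₁u₁⋯b_su_s back into u₁b₁⋯u_sb_s.
-- None of the hypotheses k_i ≥ 1, τ ↭ [m] and d ≥ 1 is needed.
module Submission where

open import Defs
open import Data.Bool using (Bool; true; false; not; _∨_; T; if_then_else_)
open import Data.Bool.Properties using (T-≡; ∨-zeroʳ; not-involutive)
open import Data.Fin using (Fin)
open import Data.List using (List; []; _∷_; _++_; [_]; take; drop; length; foldl; last; filterᵇ; initLast; _∷ʳ′_)
open import Data.List.Properties using (++-assoc; ++-identityʳ; length-++; take++drop≡id; filter-++; filter-none; filter-reject; foldl-∷ʳ)
open import Data.List.Membership.Propositional using (_∈_; _∉_)
open import Data.List.Membership.Propositional.Properties using (∈-filter⁻)
open import Data.List.Relation.Unary.All as All using (All)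
open import Data.List.Relation.Unary.Any using (here)
open import Data.List.Relation.Binary.Permutation.Propositional using (_↭_; prep; ↭-refl; ↭-sym; ↭-trans; ↭-reflexive)
open import Data.List.Relation.Binary.Permutation.Propositional.Properties using (shift; ++⁺ˡ; ++⁺ʳ; ↭-length)
open import Data.Maybe using (just; nothing)
open import Data.Nat using (ℕ; zero; suc; _≤_; _+_; _∸_; _≤ᵇ_; _<ᵇ_; _≡ᵇ_)
open import Data.Nat.Properties using (≤ᵇ⇒≤; <ᵇ⇒<; <⇒≤; ≡ᵇ⇒≡; ≡⇒≡ᵇ; m≤m+n; +-comm; suc-injective)
open import Data.Product using (_×_; _,_; Σ-syntax; ∃; ∃₂; proj₁; proj₂)
open import Data.Sum using (_⊎_; inj₁; inj₂)
import Data.Sum as Sum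
open import Function using (_∘_; Equivalence)
open import Relation.Nullary using (¬_)
open import Relation.Nullary.Decidable using (T?)
open import Relation.Binary.PropositionalEquality using (_≡_; refl; sym; trans; cong; cong₂; subst; module ≡-Reasoning)
open ≡-Reasoning

<ᵇ-suc : ∀ m n → (m <ᵇ suc n) ≡ (m ≤ᵇ n)
<ᵇ-suc zero    n = refl
<ᵇ-suc (suc m) n = refl

not-<ᵇ : ∀ m n → not (m <ᵇ n) ≡ (n ≤ᵇ m)
not-<ᵇ m       zero    = refl
not-<ᵇ zero    (suc n) = refl
not-<ᵇ (suc m) (suc n) = trans (not-<ᵇ m n) (sym (<ᵇ-suc n m))

not-≤ᵇ : ∀ m n → not (m ≤ᵇ n) ≡ (n <ᵇ m)
not-≤ᵇ zero    n = refl
not-≤ᵇ (suc m) n = trans (not-<ᵇ m n) (sym (<ᵇ-suc n m))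

take-length-++ : ∀ {A : Set} (xs ys : List A) → take (length xs) (xs ++ ys) ≡ xs
take-length-++ []       ys = refl
take-length-++ (x ∷ xs) ys = cong (x ∷_) (take-length-++ xs ys)

last≡nothing : ∀ {A : Set} (v : List A) → last v ≡ nothing → v ≡ []
last≡nothing []          _ = refl
last≡nothing (a ∷ [])    ()
last≡nothing (a ∷ b ∷ v) e with last≡nothing (b ∷ v) e
... | ()

last-∷ʳ : ∀ {A : Set} (v : List A) l → last (v ++ [ l ]) ≡ just l
last-∷ʳ []          l = refl
last-∷ʳ (a ∷ [])    l = refl
last-∷ʳ (a ∷ b ∷ v) l = last-∷ʳ (b ∷ v) l

take-++-drop : ∀ {A : Set} n (xs ys : List A) → length ys ≡ length (take n xs) → take n (ys ++ drop n xs) ≡ ys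
take-++-drop zero    xs       []       _  = refl
take-++-drop (suc n) []       []       _  = refl
take-++-drop (suc n) (x ∷ xs) (y ∷ ys) eq = cong (y ∷_) (take-++-drop n xs ys (suc-injective eq))

drop-++-drop : ∀ {A : Set} n (xs ys : List A) → length ys ≡ length (take n xs) → drop n (ys ++ drop n xs) ≡ drop n xs
drop-++-drop zero    xs       []       _  = refl
drop-++-drop (suc n) []       []       _  = refl
drop-++-drop (suc n) (x ∷ xs) (y ∷ ys) eq = drop-++-drop n xs ys (suc-injective eq)

filterᵇ-comm : ∀ p q (l : List ℕ) → filterᵇ p (filterᵇ q l) ≡ filterᵇ q (filterᵇ p l)
filterᵇ-comm p q [] = refl
filterᵇ-comm p q (y ∷ l) with p y in py | q y in qy
... | true  | true  rewrite py | qy = cong (y ∷_) (filterᵇ-comm p q l)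
... | true  | false rewrite qy = filterᵇ-comm p q l
... | false | true  rewrite py = filterᵇ-comm p q l
... | false | false = filterᵇ-comm p q l

filterᵇ-++-reject : ∀ p (u : List ℕ) y → filterᵇ p u ≡ [] → p y ≡ false → filterᵇ p (u ++ [ y ]) ≡ []
filterᵇ-++-reject p u y none py =
  trans (filter-++ (T? ∘ p) u [ y ]) (cong₂ _++_ none (filter-reject (T? ∘ p) (subst T py)))

complement-[]⇒filterᵇ-id : ∀ {p q} → (∀ y → not (p y) ≡ q y) →
  ∀ (l : List ℕ) → filterᵇ q l ≡ [] → filterᵇ p l ≡ l
complement-[]⇒filterᵇ-id c [] _ = refl
complement-[]⇒filterᵇ-id {p} {q} c (y ∷ l) none with p y | q y | c y
... | true  | false | refl = cong (y ∷_) (complement-[]⇒filterᵇ-id c l none)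
... | false | true  | refl with none
... | ()

≡-by-filterᵇ : ∀ {p q} → (∀ y → not (p y) ≡ q y) → ∀ {u v : List ℕ} →
  filterᵇ p u ≡ filterᵇ p v → filterᵇ q u ≡ filterᵇ q v → filterᵇ q u ≡ [] → u ≡ v
≡-by-filterᵇ {p} {q} c {u} {v} eqp eqq none = begin
  u           ≡⟨ sym (complement-[]⇒filterᵇ-id c u none) ⟩
  filterᵇ p u ≡⟨ eqp ⟩
  filterᵇ p v ≡⟨ complement-[]⇒filterᵇ-id c v (trans (sym eqq) none) ⟩
  v           ∎

-- Tail permutations

elemᵇ-++ : ∀ a u z → elemᵇ a (u ++ z) ≡ elemᵇ a u ∨ elemᵇ a z
elemᵇ-++ a []      z = refl
elemᵇ-++ a (y ∷ u) z with a ≡ᵇ y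
... | true  = refl
... | false = elemᵇ-++ a u z

elemᵇ-++-∷ : ∀ x u z → elemᵇ x (u ++ x ∷ z) ≡ true
elemᵇ-++-∷ x u z rewrite elemᵇ-++ x u (x ∷ z) | Equivalence.to T-≡ (≡⇒≡ᵇ x x refl) =
  ∨-zeroʳ (elemᵇ x u)

elemᵇ-filterᵇ : ∀ p {a} l → p a ≡ true → elemᵇ a (filterᵇ p l) ≡ elemᵇ a l
elemᵇ-filterᵇ p [] pa = refl
elemᵇ-filterᵇ p {a} (y ∷ l) pa with p y in py
... | true = cong ((a ≡ᵇ y) ∨_) (elemᵇ-filterᵇ p l pa)
... | false with a ≡ᵇ y in a≡y
...   | false = elemᵇ-filterᵇ p l pa
...   | true with ≡ᵇ⇒≡ a y (subst T (sym a≡y) _)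
...     | refl with trans (sym pa) py
...       | ()

tailPerm-filterᵇ : ∀ p l → tailPerm (filterᵇ p l) ≡ filterᵇ p (tailPerm l)
tailPerm-filterᵇ p [] = refl
tailPerm-filterᵇ p (y ∷ l) with p y in py
... | true rewrite elemᵇ-filterᵇ p l py with elemᵇ y l
...   | true  = tailPerm-filterᵇ p l
...   | false rewrite py = cong (y ∷_) (tailPerm-filterᵇ p l)
tailPerm-filterᵇ p (y ∷ l) | false with elemᵇ y l
...   | true  = tailPerm-filterᵇ p l
...   | false rewrite py = tailPerm-filterᵇ p l

notElemᵇ : List ℕ → ℕ → Bool
notElemᵇ z a = not (elemᵇ a z)

tailPerm-++ : ∀ u z → tailPerm (u ++ z) ≡ filterᵇ (notElemᵇ z) (tailPerm u) ++ tailPerm z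
tailPerm-++ []      z = refl
tailPerm-++ (a ∷ u) z rewrite elemᵇ-++ a u z with elemᵇ a u | elemᵇ a z in a∈z
... | true  | _     = tailPerm-++ u z
... | false | true  rewrite a∈z = tailPerm-++ u z
... | false | false rewrite a∈z = cong (a ∷_) (tailPerm-++ u z)

Consecutive-++⁻ˡ : ∀ P R → Consecutive (P ++ R) → ConsecutiveSet P
Consecutive-++⁻ˡ P R consecutive = subst ConsecutiveSet (take-length-++ P R)
  (consecutive (length P) (subst (length P ≤_) (sym (length-++ P)) (m≤m+n (length P) (length R))))

ConsecutiveSet-oneSide : ∀ x P → ConsecutiveSet P → x ∉ P →
  filterᵇ (x <ᵇ_) P ≡ [] ⊎ filterᵇ (_≤ᵇ x) P ≡ []
ConsecutiveSet-oneSide x P consecutive x∉P with filterᵇ (x <ᵇ_) P in above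
... | []    = inj₁ refl
... | b ∷ _ = inj₂ (filter-none (T? ∘ (_≤ᵇ x)) (All.tabulate notBelow))
  where
  b∈P×x<b : b ∈ P × T (x <ᵇ b)
  b∈P×x<b = ∈-filter⁻ (T? ∘ (x <ᵇ_)) (subst (b ∈_) (sym above) (here refl))

  notBelow : ∀ {a} → a ∈ P → ¬ T (a ≤ᵇ x)
  notBelow {a} a∈P a≤x = x∉P (consecutive a b x a∈P (proj₁ b∈P×x<b)
    (≤ᵇ⇒≤ a x a≤x) (<⇒≤ (<ᵇ⇒< x b (proj₂ b∈P×x<b))))

record SameSplit (x : ℕ) (u v : List ℕ) : Set where
  constructor sameSplit
  field
    small : filterᵇ (_≤ᵇ x) u ≡ filterᵇ (_≤ᵇ x) v
    large : filterᵇ (x <ᵇ_) u ≡ filterᵇ (x <ᵇ_) v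

SameSplit-sym : ∀ {x u v} → SameSplit x u v → SameSplit x v u
SameSplit-sym (sameSplit small large) = sameSplit (sym small) (sym large)

tailPerm-++-SameSplit : ∀ {x A A′} Z → SameSplit x A A′ → elemᵇ x Z ≡ true →
  Consecutive (tailPerm (A ++ Z)) → tailPerm (A ++ Z) ≡ tailPerm (A′ ++ Z)
tailPerm-++-SameSplit {x} {A} {A′} Z (sameSplit small large) x∈Z consecutive = begin
  tailPerm (A ++ Z)  ≡⟨ tailPerm-++ A Z ⟩
  P ++ tailPerm Z    ≡⟨ cong (_++ tailPerm Z) P≡P′ ⟩
  P′ ++ tailPerm Z   ≡⟨ sym (tailPerm-++ A′ Z) ⟩
  tailPerm (A′ ++ Z) ∎
  where
  P P′ : List ℕ
  P  = filterᵇ (notElemᵇ Z) (tailPerm A)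
  P′ = filterᵇ (notElemᵇ Z) (tailPerm A′)

  filterᵇ-P : ∀ p → filterᵇ p A ≡ filterᵇ p A′ → filterᵇ p P ≡ filterᵇ p P′
  filterᵇ-P p eq = begin
    filterᵇ p P                                    ≡⟨ filterᵇ-comm p (notElemᵇ Z) (tailPerm A) ⟩
    filterᵇ (notElemᵇ Z) (filterᵇ p (tailPerm A))  ≡⟨ cong (filterᵇ (notElemᵇ Z)) (sym (tailPerm-filterᵇ p A)) ⟩
    filterᵇ (notElemᵇ Z) (tailPerm (filterᵇ p A))  ≡⟨ cong (filterᵇ (notElemᵇ Z) ∘ tailPerm) eq ⟩
    filterᵇ (notElemᵇ Z) (tailPerm (filterᵇ p A′)) ≡⟨ cong (filterᵇ (notElemᵇ Z)) (tailPerm-filterᵇ p A′) ⟩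
    filterᵇ (notElemᵇ Z) (filterᵇ p (tailPerm A′)) ≡⟨ filterᵇ-comm (notElemᵇ Z) p (tailPerm A′) ⟩
    filterᵇ p P′                                   ∎

  x∉P : x ∉ P
  x∉P x∈P = subst (T ∘ not) x∈Z (proj₂ (∈-filter⁻ (T? ∘ notElemᵇ Z) {xs = tailPerm A} x∈P))

  P≡P′ : P ≡ P′
  P≡P′ with ConsecutiveSet-oneSide x P
    (Consecutive-++⁻ˡ P (tailPerm Z) (subst Consecutive (tailPerm-++ A Z) consecutive)) x∉P
  ... | inj₁ noLarge = ≡-by-filterᵇ (λ y → not-≤ᵇ y x) (filterᵇ-P _ small) (filterᵇ-P _ large) noLarge
  ... | inj₂ noSmall = ≡-by-filterᵇ (λ y → not-<ᵇ x y) (filterᵇ-P _ large) (filterᵇ-P _ small) noSmall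

-- The operator J_x and a right inverse

jAux-↭ : ∀ p acc v → jAux p acc v ↭ acc ++ v
jAux-↭ p acc []      = ↭-reflexive (sym (++-identityʳ acc))
jAux-↭ p acc (y ∷ v) with p y
... | true  = ↭-trans (prep y (++⁺ˡ acc (jAux-↭ p [] v))) (↭-sym (shift y acc v))
... | false = ↭-trans (jAux-↭ p (acc ++ [ y ]) v) (↭-reflexive (++-assoc acc [ y ] v))

filterᵇ-jAux : ∀ p acc v → filterᵇ p acc ≡ [] → filterᵇ p (jAux p acc v) ≡ filterᵇ p v
filterᵇ-jAux p acc []      none = none
filterᵇ-jAux p acc (y ∷ v) none with p y in py
... | true rewrite py | filter-++ (T? ∘ p) acc (jAux p [] v) | none =
  cong (y ∷_) (filterᵇ-jAux p [] v refl)
... | false = filterᵇ-jAux p (acc ++ [ y ]) v (filterᵇ-++-reject p acc y none py)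

filterᵇ-complement-jAux : ∀ {p q} → (∀ y → not (p y) ≡ q y) →
  ∀ acc v → filterᵇ q (jAux p acc v) ≡ filterᵇ q (acc ++ v)
filterᵇ-complement-jAux c acc [] = cong (filterᵇ _) (sym (++-identityʳ acc))
filterᵇ-complement-jAux {p} {q} c acc (y ∷ v) with p y in py
... | true = begin
  filterᵇ q (y ∷ acc ++ jAux p [] v)      ≡⟨ reject ⟩
  filterᵇ q (acc ++ jAux p [] v)          ≡⟨ filter-++ (T? ∘ q) acc _ ⟩
  filterᵇ q acc ++ filterᵇ q (jAux p [] v) ≡⟨ cong (filterᵇ q acc ++_) (filterᵇ-complement-jAux c [] v) ⟩
  filterᵇ q acc ++ filterᵇ q v            ≡⟨ cong (filterᵇ q acc ++_) (sym reject) ⟩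
  filterᵇ q acc ++ filterᵇ q (y ∷ v)      ≡⟨ filter-++ (T? ∘ q) acc (y ∷ v) ⟨
  filterᵇ q (acc ++ y ∷ v)                ∎
  where
  reject : ∀ {l} → filterᵇ q (y ∷ l) ≡ filterᵇ q l
  reject = filter-reject (T? ∘ q) (subst T (trans (sym (c y)) (cong not py)))
... | false = trans (filterᵇ-complement-jAux c (acc ++ [ y ]) v) (cong (filterᵇ q) (++-assoc acc [ y ] v))

J-cases : ∀ x v → J x v ≡ jAux (_≤ᵇ x) [] v ⊎ J x v ≡ jAux (x <ᵇ_) [] v
J-cases x v with last v in e
... | nothing rewrite last≡nothing v e = inj₁ refl
... | just l with l ≤ᵇ x
...   | true  = inj₁ refl
...   | false = inj₂ refl

J-SameSplit : ∀ x v → SameSplit x (J x v) v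
J-SameSplit x v with J-cases x v
... | inj₁ eq rewrite eq = sameSplit (filterᵇ-jAux (_≤ᵇ x) [] v refl) (filterᵇ-complement-jAux (λ y → not-≤ᵇ y x) [] v)
... | inj₂ eq rewrite eq = sameSplit (filterᵇ-complement-jAux (λ y → not-<ᵇ x y) [] v) (filterᵇ-jAux (x <ᵇ_) [] v refl)

J-↭ : ∀ x v → J x v ↭ v
J-↭ x v with J-cases x v
... | inj₁ eq rewrite eq = jAux-↭ _ [] v
... | inj₂ eq rewrite eq = jAux-↭ _ [] v

side : ℕ → ℕ → ℕ → Bool
side x b = if b ≤ᵇ x then (_≤ᵇ x) else (x <ᵇ_)

side-self : ∀ x b → side x b b ≡ true
side-self x b with b ≤ᵇ x in b≤x
... | true  = b≤x
... | false = trans (sym (not-≤ᵇ b x)) (cong not b≤x)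

side-≡ : ∀ x b l → side x b l ≡ true → side x l ≡ side x b
side-≡ x b l sameSide with b ≤ᵇ x
... | true rewrite sameSide = refl
... | false rewrite trans (sym (not-involutive (l ≤ᵇ x))) (cong not (trans (not-≤ᵇ l x) sameSide)) = refl

J-last : ∀ x v l → last v ≡ just l → J x v ≡ jAux (side x l) [] v
J-last x v l e with last v
J-last x v l refl | just .l with l ≤ᵇ x
... | true  = refl
... | false = refl

-- unjAux p b u o reads the rest of b₁u₁⋯b_su_s, where b is the current b-letter and u the
-- part of its u-block read so far, and writes u₁b₁⋯u_sb_s.
unjAux : (ℕ → Bool) → ℕ → List ℕ → List ℕ → List ℕ
unjAux p b u []      = u ++ [ b ]
unjAux p b u (y ∷ o) = if p y then u ++ b ∷ unjAux p y [] o else unjAux p b (u ++ [ y ]) o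

unJ : ℕ → List ℕ → List ℕ
unJ x []      = []
unJ x (b ∷ o) = unjAux (side x b) b [] o

jAux-++ : ∀ p acc u v → filterᵇ p u ≡ [] → jAux p acc (u ++ v) ≡ jAux p (acc ++ u) v
jAux-++ p acc []      v _ = cong (λ acc′ → jAux p acc′ v) (sym (++-identityʳ acc))
jAux-++ p acc (a ∷ u) v none with p a
... | false = trans (jAux-++ p (acc ++ [ a ]) u v none) (cong (λ acc′ → jAux p acc′ v) (++-assoc acc [ a ] u))
jAux-++ p acc (a ∷ u) v () | true

jAux-unjAux : ∀ p b u o → p b ≡ true → filterᵇ p u ≡ [] → jAux p [] (unjAux p b u o) ≡ b ∷ u ++ o
jAux-unjAux p b u [] pb none rewrite jAux-++ p [] u [ b ] none | pb = refl
jAux-unjAux p b u (y ∷ o) pb none with p y in py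
... | true rewrite jAux-++ p [] u (b ∷ unjAux p y [] o) none | pb | jAux-unjAux p y [] o py refl = refl
... | false rewrite jAux-unjAux p b (u ++ [ y ]) o pb (filterᵇ-++-reject p u y none py) | ++-assoc u [ y ] o = refl

unjAux-∷ʳ : ∀ p b u o → p b ≡ true → ∃₂ λ v l → unjAux p b u o ≡ v ++ [ l ] × p l ≡ true
unjAux-∷ʳ p b u []      pb = u , b , refl , pb
unjAux-∷ʳ p b u (y ∷ o) pb with p y in py
... | false = unjAux-∷ʳ p b (u ++ [ y ]) o pb
... | true with unjAux-∷ʳ p y [] o py
...   | v , l , eq , pl = u ++ b ∷ v , l , trans (cong (λ t → u ++ b ∷ t) eq) (sym (++-assoc u (b ∷ v) [ l ])) , pl

unjAux-↭ : ∀ p b u o → unjAux p b u o ↭ b ∷ u ++ o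
unjAux-↭ p b u []      = shift b u []
unjAux-↭ p b u (y ∷ o) with p y
... | true  = ↭-trans (++⁺ˡ u (prep b (unjAux-↭ p y [] o))) (shift b u (y ∷ o))
... | false = ↭-trans (unjAux-↭ p b (u ++ [ y ]) o) (↭-reflexive (cong (b ∷_) (++-assoc u [ y ] o)))

J-unJ : ∀ x o → J x (unJ x o) ≡ o
J-unJ x []      = refl
J-unJ x (b ∷ o) with unjAux-∷ʳ (side x b) b [] o (side-self x b)
... | v , l , eq , l-side = begin
  J x o′                ≡⟨ J-last x o′ l (trans (cong last eq) (last-∷ʳ v l)) ⟩
  jAux (side x l) [] o′ ≡⟨ cong (λ p → jAux p [] o′) (side-≡ x b l l-side) ⟩
  jAux (side x b) [] o′ ≡⟨ jAux-unjAux (side x b) b [] o (side-self x b) refl ⟩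
  b ∷ o                 ∎
  where o′ = unjAux (side x b) b [] o

unJ-↭ : ∀ x o → unJ x o ↭ o
unJ-↭ x []      = ↭-refl
unJ-↭ x (b ∷ o) = unjAux-↭ (side x b) b [] o

-- The map F_d

-- For i < d the step only appends x, which is the general step with the empty prefix,
-- since J_x [] = [].
Fstep-J : ∀ d γ x → ∃₂ λ A B → γ ≡ A ++ B × Fstep d γ x ≡ J x A ++ B ++ [ x ]
Fstep-J d γ x with length γ <ᵇ d
... | true  = [] , γ , refl , refl
... | false = take k γ , drop k γ , sym (take++drop≡id k γ) , refl
  where k = length γ ∸ d + 1

Fstep-↭ : ∀ d γ x → Fstep d γ x ↭ γ ++ [ x ]
Fstep-↭ d γ x with Fstep-J d γ x
... | A , B , refl , eq = ↭-trans (↭-reflexive eq)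
  (↭-trans (++⁺ʳ (B ++ [ x ]) (J-↭ x A)) (↭-reflexive (sym (++-assoc A B [ x ]))))

tailPerm-J-prefix : ∀ x A Z → elemᵇ x Z ≡ true →
  Consecutive (tailPerm (A ++ Z)) ⊎ Consecutive (tailPerm (J x A ++ Z)) →
  tailPerm (J x A ++ Z) ≡ tailPerm (A ++ Z)
tailPerm-J-prefix x A Z x∈Z (inj₁ consecutive) =
  sym (tailPerm-++-SameSplit Z (SameSplit-sym (J-SameSplit x A)) x∈Z consecutive)
tailPerm-J-prefix x A Z x∈Z (inj₂ consecutive) =
  tailPerm-++-SameSplit Z (J-SameSplit x A) x∈Z consecutive

tailPerm-Fstep : ∀ d γ x R →
  Consecutive (tailPerm (γ ++ x ∷ R)) ⊎ Consecutive (tailPerm (Fstep d γ x ++ R)) →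
  tailPerm (Fstep d γ x ++ R) ≡ tailPerm (γ ++ x ∷ R)
tailPerm-Fstep d γ x R consecutive with Fstep-J d γ x
... | A , B , refl , eq = begin
  tailPerm (Fstep d (A ++ B) x ++ R) ≡⟨ cong tailPerm after ⟩
  tailPerm (J x A ++ Z)              ≡⟨ tailPerm-J-prefix x A Z (elemᵇ-++-∷ x B R)
                                          (Sum.map (subst (Consecutive ∘ tailPerm) before)
                                                   (subst (Consecutive ∘ tailPerm) after) consecutive) ⟩
  tailPerm (A ++ Z)                  ≡⟨ cong tailPerm before ⟨
  tailPerm ((A ++ B) ++ x ∷ R)       ∎
  where
  Z = B ++ x ∷ R
  before : (A ++ B) ++ x ∷ R ≡ A ++ Z
  before = ++-assoc A B (x ∷ R)
  after : Fstep d (A ++ B) x ++ R ≡ J x A ++ Z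
  after = trans (cong (_++ R) eq) (trans (++-assoc (J x A) (B ++ [ x ]) R) (cong (J x A ++_) (++-assoc B [ x ] R)))

Fstep-< : ∀ d γ x → (length γ <ᵇ d) ≡ true → Fstep d γ x ≡ γ ++ [ x ]
Fstep-< d γ x e with length γ <ᵇ d
Fstep-< d γ x refl | true = refl

Fstep-≮ : ∀ d γ x → (length γ <ᵇ d) ≡ false →
  Fstep d γ x ≡ J x (take (length γ ∸ d + 1) γ) ++ drop (length γ ∸ d + 1) γ ++ [ x ]
Fstep-≮ d γ x e with length γ <ᵇ d
Fstep-≮ d γ x refl | false = refl

Fstep-rightInverse : ∀ d γ′ x → ∃ λ γ → length γ ≡ length γ′ × Fstep d γ x ≡ γ′ ++ [ x ]
Fstep-rightInverse d γ′ x with length γ′ <ᵇ d in short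
... | true  = γ′ , refl , Fstep-< d γ′ x short
... | false = γ , sameLength , (begin
  Fstep d γ x                               ≡⟨ Fstep-≮ d γ x (trans (cong (_<ᵇ d) sameLength) short) ⟩
  J x (take k′ γ) ++ drop k′ γ ++ [ x ]     ≡⟨ cong (λ n → J x (take (n ∸ d + 1) γ) ++ drop (n ∸ d + 1) γ ++ [ x ]) sameLength ⟩
  J x (take k γ) ++ drop k γ ++ [ x ]       ≡⟨ cong₂ (λ a b → J x a ++ b ++ [ x ]) (take-++-drop k γ′ A′ lengthA′) (drop-++-drop k γ′ A′ lengthA′) ⟩
  J x A′ ++ drop k γ′ ++ [ x ]              ≡⟨ cong (_++ drop k γ′ ++ [ x ]) (J-unJ x (take k γ′)) ⟩
  take k γ′ ++ drop k γ′ ++ [ x ]           ≡⟨ ++-assoc (take k γ′) (drop k γ′) [ x ] ⟨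
  (take k γ′ ++ drop k γ′) ++ [ x ]         ≡⟨ cong (_++ [ x ]) (take++drop≡id k γ′) ⟩
  γ′ ++ [ x ]                               ∎)
  where
  k = length γ′ ∸ d + 1
  A′ = unJ x (take k γ′)
  γ = A′ ++ drop k γ′
  k′ = length γ ∸ d + 1
  lengthA′ : length A′ ≡ length (take k γ′)
  lengthA′ = ↭-length (unJ-↭ x (take k γ′))
  sameLength : length γ ≡ length γ′
  sameLength = trans (↭-length (++⁺ʳ (drop k γ′) (unJ-↭ x (take k γ′)))) (cong length (take++drop≡id k γ′))

module _ {A : Set} (f : List A → A → List A) where

  foldl-↭ : (∀ γ x → f γ x ↭ γ ++ [ x ]) → ∀ γ w → foldl f γ w ↭ γ ++ w
  foldl-↭ step γ []      = ↭-reflexive (sym (++-identityʳ γ))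
  foldl-↭ step γ (x ∷ w) = ↭-trans (foldl-↭ step (f γ x) w)
    (↭-trans (++⁺ʳ w (step γ x)) (↭-reflexive (++-assoc γ [ x ] w)))

  foldl-surjective : (∀ γ′ x → ∃ λ γ → length γ ≡ length γ′ × f γ x ≡ γ′ ++ [ x ]) →
    ∀ v → ∃ λ w → foldl f [] w ≡ v
  foldl-surjective rightInverse v = go (length v) v refl
    where
    length-∷ʳ : ∀ (u : List A) x → length (u ++ [ x ]) ≡ suc (length u)
    length-∷ʳ u x = trans (length-++ u) (+-comm (length u) 1)

    go : ∀ n u → length u ≡ n → ∃ λ w → foldl f [] w ≡ u
    go n u len with initLast u
    go n       .[]            len | []       = [] , refl
    go zero    .(u′ ++ [ x ]) len | u′ ∷ʳ′ x with () ← trans (sym (length-∷ʳ u′ x)) len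
    go (suc n) .(u′ ++ [ x ]) len | u′ ∷ʳ′ x with rightInverse u′ x
    ... | γ , sameLength , fγ with go n γ (trans sameLength (suc-injective (trans (sym (length-∷ʳ u′ x)) len)))
    ...   | w , fw = w ++ [ x ] , trans (foldl-∷ʳ f [] x w) (trans (cong (λ γ′ → f γ′ x) fw) fγ)

tailPerm-foldl-Fstep : ∀ d γ w → Consecutive (tailPerm (γ ++ w)) →
  tailPerm (foldl (Fstep d) γ w) ≡ tailPerm (γ ++ w)
tailPerm-foldl-Fstep d γ []      _           = cong tailPerm (sym (++-identityʳ γ))
tailPerm-foldl-Fstep d γ (x ∷ w) consecutive =
  trans (tailPerm-foldl-Fstep d (Fstep d γ x) w (subst Consecutive (sym step) consecutive)) step
  where step = tailPerm-Fstep d γ x w (inj₁ consecutive)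

tailPerm-foldl-Fstep⁻ : ∀ d γ w → Consecutive (tailPerm (foldl (Fstep d) γ w)) →
  tailPerm (foldl (Fstep d) γ w) ≡ tailPerm (γ ++ w)
tailPerm-foldl-Fstep⁻ d γ []      _           = cong tailPerm (sym (++-identityʳ γ))
tailPerm-foldl-Fstep⁻ d γ (x ∷ w) consecutive =
  trans ih (tailPerm-Fstep d γ x w (inj₂ (subst Consecutive ih consecutive)))
  where ih = tailPerm-foldl-Fstep⁻ d (Fstep d γ x) w consecutive

F-↭ : ∀ d w → F d w ↭ w
F-↭ d = foldl-↭ (Fstep d) (Fstep-↭ d) []

F-surjective : ∀ d v → ∃ λ w → F d w ≡ v
F-surjective d = foldl-surjective (Fstep d) (Fstep-rightInverse d)

proposition4p3 : (m : ℕ) (k : Fin m → ℕ) → (∀ i → 1 ≤ k i) →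
    (τ : List ℕ) → τ ↭ range1 m → Consecutive τ →
    (d : ℕ) → 1 ≤ d →
    ((w : List ℕ) → InSτ m k τ w → InSτ m k τ (F d w))
    × ((v : List ℕ) → InSτ m k τ v → Σ[ w ∈ List ℕ ] (InSτ m k τ w × F d w ≡ v))
proposition4p3 m k _ τ _ τ-consecutive d _ = F-into , F-onto
  where
  F-into : (w : List ℕ) → InSτ m k τ w → InSτ m k τ (F d w)
  F-into w (w↭M , tw≡τ) =
    ↭-trans (F-↭ d w) w↭M ,
    trans (tailPerm-foldl-Fstep d [] w (subst Consecutive (sym tw≡τ) τ-consecutive)) tw≡τ

  F-onto : (v : List ℕ) → InSτ m k τ v → Σ[ w ∈ List ℕ ] (InSτ m k τ w × F d w ≡ v)
  F-onto v (v↭M , tv≡τ) with F-surjective d v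
  ... | w , refl =
    w , (↭-trans (↭-sym (F-↭ d w)) v↭M ,
         trans (sym (tailPerm-foldl-Fstep⁻ d [] w (subst Consecutive (sym tv≡τ) τ-consecutive))) tv≡τ) ,
    refl
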